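{- Let $\mathbf{A}$ be a relational structure and $k\geq1$. Then $\mathbf{A}$ is $k$-polymorphism-homogeneous if and only if $\mathbf{A}^k$ is homomorphism-homogeneous.
   Context: $\mathbf{A}^k$ is the direct power of $\mathbf{A}$ (carrier $A^k$, relations defined coordinatewise). A $k$-ary polymorphism of $\mathbf{A}$ is a homomorphism $\mathbf{A}^k\to\mathbf{A}$; a $k$-ary local polymorphism is a homomorphism from a finite induced substructure of $\mathbf{A}^k$ to $\mathbf{A}$. $\mathbf{A}$ is $k$-polymorphism-homogeneous if every $k$-ary local polymorphism extends to a $k$-ary polymorphism. A structure $\mathbf{B}$ is homomorphism-homogeneous if every homomorphism from a finite induced substructure of $\mathbf{B}$ to $\mathbf{B}$ extends to an endomorphism of $\mathbf{B}$. -}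

module Defs where

open import Data.Nat using (ℕ)
open import Data.Fin using (Fin)
open import Data.Vec using (Vec; lookup)
open import Data.List using (List)
open import Data.List.Membership.Propositional using (_∈_)
open import Data.Product using (Σ; _×_)
open import Relation.Binary.PropositionalEquality using (_≡_)

record Signature : Set₁ where
  field
    Sym : Set
    ar  : Sym → ℕ
open Signature public

record Structure (σ : Signature) : Set₁ where
  field
    Carrier : Set
    Rel     : (s : Sym σ) → (Fin (ar σ s) → Carrier) → Set
open Structure public

module _ {σ : Signature} where

  _^ˢ_ : Structure σ → ℕ → Structure σ
  Carrier (A ^ˢ k) = Vec (Carrier A) k
  Rel (A ^ˢ k) s t = (j : Fin k) → Rel A s (λ m → lookup (t m) j)

  IsHom : (A B : Structure σ) → (Carrier A → Carrier B) → Set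
  IsHom A B g = (s : Sym σ) (t : Fin (ar σ s) → Carrier A) →
                Rel A s t → Rel B s (λ m → g (t m))

  -- A map defined on a finite subset of A (given by a list xs of its elements),
  -- well-defined (independent of the membership witness).
  PartialMap : (A B : Structure σ) → List (Carrier A) → Set
  PartialMap A B xs = (a : Carrier A) → a ∈ xs → Carrier B

  WellDefined : (A B : Structure σ) (xs : List (Carrier A)) → PartialMap A B xs → Set
  WellDefined A B xs f = (a : Carrier A) (p q : a ∈ xs) → f a p ≡ f a q

  IsLocalHom : (A B : Structure σ) (xs : List (Carrier A)) → PartialMap A B xs → Set
  IsLocalHom A B xs f =
    WellDefined A B xs f ×
    ((s : Sym σ) (t : Fin (ar σ s) → Carrier A) (inS : (m : Fin (ar σ s)) → t m ∈ xs) →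
      Rel A s t → Rel B s (λ m → f (t m) (inS m)))

  ExtendsToHom : (A B : Structure σ) (xs : List (Carrier A)) → PartialMap A B xs → Set
  ExtendsToHom A B xs f =
    Σ (Carrier A → Carrier B) λ g →
      IsHom A B g × ((a : Carrier A) (p : a ∈ xs) → g a ≡ f a p)

  LocalHomsExtend : (A B : Structure σ) → Set
  LocalHomsExtend A B =
    (xs : List (Carrier A)) (f : PartialMap A B xs) →
    IsLocalHom A B xs f → ExtendsToHom A B xs f

  PolymorphismHomogeneous : ℕ → Structure σ → Set
  PolymorphismHomogeneous k A = LocalHomsExtend (A ^ˢ k) A

  HomomorphismHomogeneous : Structure σ → Set
  HomomorphismHomogeneous B = LocalHomsExtend B B

-- A k-ary local polymorphism is a local homomorphism A^k ⇀ A, and a local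
-- homomorphism into A^k is a k-tuple of local homomorphisms into A; so
-- extensions into A, taken coordinatewise, give extensions into A^k.
-- Conversely, for k ≥ 1 the diagonal A → A^k and a projection A^k → A exhibit
-- A as a retract of A^k, and extension of local homomorphisms passes to
-- retracts: extend the composite with the diagonal, then project.
module Submission where

open import Defs
open import Data.Nat using (ℕ; _≥_; suc)
open import Data.Fin using (Fin; zero; suc)
open import Data.List using (List)
open import Data.Vec using (lookup; tabulate)
open import Data.Vec.Properties using (tabulate-cong; tabulate∘lookup)
open import Data.Product using (_,_; proj₁; proj₂)
open import Function.Base using (id; _∘_)
open import Function.Bundles using (_⇔_; mk⇔)
open import Relation.Binary.PropositionalEquality
  using (_≡_; refl; trans; cong; module ≡-Reasoning)

module _ {σ : Signature} where

  IsHom-id : (A : Structure σ) → IsHom A A id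
  IsHom-id A s t r = r

  IsHom-∘ : (A B C : Structure σ) (g : Carrier B → Carrier C) (f : Carrier A → Carrier B) →
            IsHom B C g → IsHom A B f → IsHom A C (g ∘ f)
  IsHom-∘ A B C g f g-hom f-hom s t r = g-hom s _ (f-hom s t r)

  IsLocalHom-∘ : (A B C : Structure σ) (xs : List (Carrier A))
                 (g : Carrier B → Carrier C) (f : PartialMap A B xs) →
                 IsHom B C g → IsLocalHom A B xs f →
                 IsLocalHom A C xs (λ a p → g (f a p))
  IsLocalHom-∘ A B C xs g f g-hom (wd , lh) =
    (λ a p q → cong g (wd a p q)) , (λ s t inS r → g-hom s _ (lh s t inS r))

  IsHom-lookup : (A : Structure σ) {k : ℕ} (j : Fin k) → IsHom (A ^ˢ k) A (λ v → lookup v j)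
  IsHom-lookup A j s t r = r j

  -- Without function extensionality the tuple λ m → lookup (tabulate (h m)) j
  -- is only pointwise equal to λ m → h m j, so the relation is transported
  -- by recursion on j, along which lookup ∘ tabulate computes.
  Rel-lookup-tabulate : (A : Structure σ) {k : ℕ} (s : Sym σ)
                        (h : Fin (ar σ s) → Fin k → Carrier A) (j : Fin k) →
                        Rel A s (λ m → h m j) → Rel A s (λ m → lookup (tabulate (h m)) j)
  Rel-lookup-tabulate A s h zero    r = r
  Rel-lookup-tabulate A s h (suc j) r = Rel-lookup-tabulate A s (λ m → h m ∘ suc) j r

  IsHom-tabulate : (B A : Structure σ) {k : ℕ} (g : Fin k → Carrier B → Carrier A) →
                   (∀ j → IsHom B A (g j)) → IsHom B (A ^ˢ k) (λ b → tabulate (λ j → g j b))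
  IsHom-tabulate B A g g-hom s t r j =
    Rel-lookup-tabulate A s (λ m j′ → g j′ (t m)) j (g-hom j s t r)

  LocalHomsExtend-^ˢ : (B A : Structure σ) (k : ℕ) →
                       LocalHomsExtend B A → LocalHomsExtend B (A ^ˢ k)
  LocalHomsExtend-^ˢ B A k extend xs f f-local =
    (λ b → tabulate (λ j → g j b)) , IsHom-tabulate B A g g-hom , g-extends
    where
    extension : ∀ j → ExtendsToHom B A xs (λ b p → lookup (f b p) j)
    extension j = extend xs (λ b p → lookup (f b p) j)
                         (IsLocalHom-∘ B (A ^ˢ k) A xs (λ v → lookup v j) f
                                       (IsHom-lookup A j) f-local)

    g : Fin k → Carrier B → Carrier A
    g j = proj₁ (extension j)

    g-hom : ∀ j → IsHom B A (g j)
    g-hom j = proj₁ (proj₂ (extension j))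

    g-extends : ∀ b p → tabulate (λ j → g j b) ≡ f b p
    g-extends b p = trans (tabulate-cong (λ j → proj₂ (proj₂ (extension j)) b p))
                          (tabulate∘lookup (f b p))

  LocalHomsExtend-retract : (B C A : Structure σ)
                            (ι : Carrier A → Carrier C) (π : Carrier C → Carrier A) →
                            IsHom A C ι → IsHom C A π → (∀ a → π (ι a) ≡ a) →
                            LocalHomsExtend B C → LocalHomsExtend B A
  LocalHomsExtend-retract B C A ι π ι-hom π-hom π∘ι≗id extend xs f f-local =
    π ∘ G , IsHom-∘ B C A π G π-hom G-hom , πG-extends
    where
    extension : ExtendsToHom B C xs (λ b p → ι (f b p))
    extension = extend xs (λ b p → ι (f b p)) (IsLocalHom-∘ B A C xs ι f ι-hom f-local)

    G : Carrier B → Carrier C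
    G = proj₁ extension

    G-hom : IsHom B C G
    G-hom = proj₁ (proj₂ extension)

    πG-extends : ∀ b p → π (G b) ≡ f b p
    πG-extends b p = begin
      π (G b)         ≡⟨ cong π (proj₂ (proj₂ extension) b p) ⟩
      π (ι (f b p))   ≡⟨ π∘ι≗id (f b p) ⟩
      f b p           ∎
      where open ≡-Reasoning

mainTheorem10 : (σ : Signature) (A : Structure σ) (k : ℕ) → k ≥ 1 →
    PolymorphismHomogeneous k A ⇔ HomomorphismHomogeneous (A ^ˢ k)
mainTheorem10 σ A (suc n) _ = mk⇔
  (LocalHomsExtend-^ˢ (A ^ˢ suc n) A (suc n))
  (LocalHomsExtend-retract (A ^ˢ suc n) (A ^ˢ suc n) A
     diagonal (λ v → lookup v zero) diagonal-hom (IsHom-lookup A zero) (λ a → refl))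
  where
  diagonal : Carrier A → Carrier (A ^ˢ suc n)
  diagonal a = tabulate (λ _ → a)

  diagonal-hom : IsHom A (A ^ˢ suc n) diagonal
  diagonal-hom = IsHom-tabulate A A (λ _ → id) (λ _ → IsHom-id A)
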